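{- Let $G$ be a finite, simple, connected graph on at least $3$ vertices with $\Delta(G)\leq 3$, and let $M$ be a perfect matching of the line graph $L(G)$. Then $M$ is contained in some hamiltonian cycle of $L(G)$ if and only if there exists a dominating cycle $D$ of $G$ such that for every vertex $v$ of $G$ not lying on $D$, the clique $Q_v$ contains no edge of $M$ (i.e. no edge of $M$ joins two edges of $G$ that share the end-vertex $v$).
   Context: The line graph $L(G)$ has vertex set $E(G)$, two vertices adjacent when the corresponding edges of $G$ share an end-vertex. For $v\in V(G)$, $Q_v$ denotes the set of edges of $G$ incident to $v$; it induces a clique in $L(G)$, and the cliques $Q_v$ for $v$ of degree at least $2$ form the canonical clique partition of $L(G)$ (every edge of $L(G)$ lies in exactly one of them). A dominating cycle of $G$ is a cycle of $G$ such that every edge of $G$ has at least one end-vertex on the cycle. -}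

module Defs where

open import Data.Nat as ℕ using (ℕ; zero; suc; _≤_; _+_)
open import Data.Fin as Fin using (Fin; toℕ; lower₁; fromℕ)
open import Data.Fin.Subset using (Subset; ∣_∣)
open import Data.Vec using (tabulate)
open import Data.Bool using (Bool; true; false)
open import Data.Product using (Σ; ∃; _×_; _,_; proj₁; proj₂)
open import Data.Sum using (_⊎_)
open import Relation.Binary.PropositionalEquality using (_≡_)
open import Relation.Binary.Construct.Closure.ReflexiveTransitive using (Star)
open import Relation.Nullary using (¬_; yes; no)
open import Function.Definitions using (Injective)

record Graph (n : ℕ) : Set where
  field
    adj   : Fin n → Fin n → Bool
    sym   : ∀ u v → adj u v ≡ adj v u
    irrefl : ∀ u → adj u u ≡ false

module _ {n : ℕ} (G : Graph n) where
  open Graph G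

  Adj : Fin n → Fin n → Set
  Adj u v = adj u v ≡ true

  degree : Fin n → ℕ
  degree v = ∣ tabulate (adj v) ∣

  MaxDegree≤ : ℕ → Set
  MaxDegree≤ k = ∀ v → degree v ≤ k

  Connected : Set
  Connected = ∀ u v → Star Adj u v

  -- Edges of G, i.e. vertices of L(G): unordered pairs {u,v}, stored with u < v.
  GEdge : Set
  GEdge = Σ (Fin n × Fin n) λ p → (proj₁ p Fin.< proj₂ p) × Adj (proj₁ p) (proj₂ p)

  Incident : Fin n → GEdge → Set
  Incident v ((a , b) , _) = (v ≡ a) ⊎ (v ≡ b)

  LAdj : GEdge → GEdge → Set
  LAdj e f = ¬ (e ≡ f) × ∃ λ v → Incident v e × Incident v f

next : ∀ {k} → Fin (suc k) → Fin (suc k)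
next {k} i with k ℕ.≟ toℕ i
... | yes _ = Fin.zero
... | no ne = Fin.suc (lower₁ i ne)

record Cycle (V : Set) (R : V → V → Set) : Set where
  field
    m    : ℕ
    vtx  : Fin (3 + m) → V
    inj  : Injective _≡_ _≡_ vtx
    step : ∀ i → R (vtx i) (vtx (next i))

module _ {V : Set} {R : V → V → Set} (C : Cycle V R) where
  open Cycle C

  OnCycle : V → Set
  OnCycle x = ∃ λ i → vtx i ≡ x

  CycleEdge : V → V → Set
  CycleEdge x y = ∃ λ i → (vtx i ≡ x × vtx (next i) ≡ y) ⊎ (vtx i ≡ y × vtx (next i) ≡ x)

  Hamiltonian : Set
  Hamiltonian = ∀ x → OnCycle x

module _ {n : ℕ} (G : Graph n) where

  LineCycle : Set
  LineCycle = Cycle (GEdge G) (LAdj G)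

  -- A perfect matching of L(G), given as a symmetric relation on E(G)
  -- (M e f means the L(G)-edge ef is in M).
  record PerfectMatching : Set₁ where
    field
      M       : GEdge G → GEdge G → Set
      M-sym   : ∀ e f → M e f → M f e
      M-edge  : ∀ e f → M e f → LAdj G e f
      M-perf  : ∀ e → ∃ λ f → M e f × (∀ g → M e g → g ≡ f)

  Dominating : Cycle (Fin n) (Adj G) → Set
  Dominating D = ∀ u v → Adj G u v → OnCycle D u ⊎ OnCycle D v

-- A hamiltonian cycle H of L(G) is a cyclic sequence of edges of G in which consecutive edges
-- share a vertex, the turn.  The vertices at which the turn moves, read in order, form a cycle D
-- of G: with Δ ≤ 3 a vertex cannot be the turn at two separate moves (it would carry four edges
-- of H), and fewer than three moves is impossible (for L(G) = K₃ by the parity of M).  Every edge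
-- contains a turn, so D is dominating, and an M-edge, being an edge of H, lies in the clique of
-- a turn.  Conversely, walk around D and between the two cycle edges at each vertex v of D insert
-- the (by Δ ≤ 3, unique) edge off D at v when it is matched to one of them.  Every edge of M lies
-- in some Q_v with v on D, so every edge off D gets inserted and every M-edge is a step of the walk.

module Submission where

open import Defs
open import Data.Bool using (Bool; true; false; not; _≟_)
open import Data.Empty using (⊥; ⊥-elim)
open import Data.Fin as Fin using (Fin; toℕ)
open import Data.Fin.Patterns using (0F; 1F; 2F)
import Data.Fin.Properties as Finₚ
open import Data.Fin.Subset using (Subset; ∣_∣; _-_) renaming (_∈_ to _∈ₛ_)
open import Data.Fin.Subset.Properties using (x∈p∧x≢y⇒x∈p-y; x∈p⇒∣p-x∣<∣p∣)
open import Data.List using (List; []; _∷_; length; lookup; map; _++_)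
open import Data.List.Membership.Propositional using (_∈_)
open import Data.List.Membership.Propositional.Properties using (∈-++⁺ˡ; ∈-++⁺ʳ; ∈-++⁻; ∈-lookup; ∈-map⁺)
import Data.List.Properties as Listₚ
open import Data.List.Relation.Unary.All as All using (All; []; _∷_)
import Data.List.Relation.Unary.All.Properties as Allₚ
open import Data.List.Relation.Unary.AllPairs using ([]; _∷_)
import Data.List.Relation.Unary.AllPairs.Properties as AllPairs
open import Data.List.Relation.Unary.Any using (here; there; index)
open import Data.List.Relation.Unary.Any.Properties using (lookup-index)
open import Data.List.Relation.Unary.Unique.Propositional using (Unique)
open import Data.Nat as ℕ using (ℕ; zero; suc; _≤_; _<_; z≤n; s≤s; _+_; _*_; _∸_; _%_; NonZero)
open import Data.Nat.DivMod using (_mod_; m%n<n; m<n⇒m%n≡m; n%n≡0; [m+n]%n≡m%n; [m+kn]%n≡m%n; m%n%n≡m%n; %-distribˡ-+)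
import Data.Nat.Properties as ℕₚ
open import Data.Product using (Σ; ∃; _×_; _,_; proj₁; proj₂; uncurry)
open import Data.Sum using (_⊎_; inj₁; inj₂; map₂)
open import Data.Vec using (tabulate)
open import Data.Vec.Properties using (lookup⇒[]=; lookup∘tabulate)
import Axiom.UniquenessOfIdentityProofs as UIP
open import Function using (_∘_; id)
open import Function.Bundles using (_⇔_; mk⇔)
open import Relation.Binary.Definitions using (tri<; tri≈; tri>)
open import Relation.Binary.PropositionalEquality
open import Relation.Nullary using (¬_; Dec; yes; no; does)

-- Lists read cyclically

module _ {A : Set} where

  data Consec : List A → A → A → Set where
    here  : ∀ {a b xs} → Consec (a ∷ b ∷ xs) a b
    there : ∀ {x xs a b} → Consec xs a b → Consec (x ∷ xs) a b

  data Last : List A → A → Set where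
    single : ∀ {a} → Last (a ∷ []) a
    cons   : ∀ {x xs a} → Last xs a → Last (x ∷ xs) a

  Head : List A → A → Set
  Head []      a = ⊥
  Head (x ∷ _) a = x ≡ a

  CyclicConsec : List A → A → A → Set
  CyclicConsec xs a b = Consec xs a b ⊎ (Last xs a × Head xs b)

  lookup-injective : ∀ {xs : List A} → Unique xs → ∀ i j → lookup xs i ≡ lookup xs j → i ≡ j
  lookup-injective {_ ∷ _} (_ ∷ _)  Fin.zero    Fin.zero    _ = refl
  lookup-injective {_ ∷ _} (p ∷ _)  Fin.zero    (Fin.suc j) e = ⊥-elim (All.lookup p (∈-lookup j) e)
  lookup-injective {_ ∷ _} (p ∷ _)  (Fin.suc i) Fin.zero    e = ⊥-elim (All.lookup p (∈-lookup i) (sym e))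
  lookup-injective {_ ∷ _} (_ ∷ ps) (Fin.suc i) (Fin.suc j) e = cong Fin.suc (lookup-injective ps i j e)

  Consec-lookup : ∀ xs (i j : Fin (length xs)) → toℕ j ≡ suc (toℕ i) → Consec xs (lookup xs i) (lookup xs j)
  Consec-lookup (x ∷ y ∷ xs) Fin.zero    (Fin.suc Fin.zero)    e = here
  Consec-lookup (x ∷ y ∷ xs) Fin.zero    (Fin.suc (Fin.suc j)) ()
  Consec-lookup (x ∷ xs)     (Fin.suc i) (Fin.suc j)           e = there (Consec-lookup xs i j (ℕₚ.suc-injective e))

  Last-lookup : ∀ xs (i : Fin (length xs)) → suc (toℕ i) ≡ length xs → Last xs (lookup xs i)
  Last-lookup (x ∷ [])     Fin.zero    e = single
  Last-lookup (x ∷ y ∷ xs) Fin.zero    ()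
  Last-lookup (x ∷ xs)     (Fin.suc i) e = cons (Last-lookup xs i (ℕₚ.suc-injective e))

  lookup-Consec : ∀ {xs a b} → Consec xs a b →
                  ∃ λ i → ∃ λ j → toℕ j ≡ suc (toℕ i) × lookup xs i ≡ a × lookup xs j ≡ b
  lookup-Consec here = Fin.zero , Fin.suc Fin.zero , refl , refl , refl
  lookup-Consec (there c) with lookup-Consec c
  ... | i , j , e , p , q = Fin.suc i , Fin.suc j , cong suc e , p , q

  lookup-Last : ∀ {xs a} → Last xs a → ∃ λ i → suc (toℕ i) ≡ length xs × lookup xs i ≡ a
  lookup-Last single = Fin.zero , refl , refl
  lookup-Last (cons l) with lookup-Last l
  ... | i , e , p = Fin.suc i , cong suc e , p

  Consec-∷⁻ : ∀ {x xs a b} → Consec (x ∷ xs) a b → (a ≡ x × Head xs b) ⊎ Consec xs a b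
  Consec-∷⁻ here      = inj₁ (refl , refl)
  Consec-∷⁻ (there c) = inj₂ c

  Last-∷⁻ : ∀ {x xs a} → Last (x ∷ xs) a → (xs ≡ [] × a ≡ x) ⊎ Last xs a
  Last-∷⁻ single   = inj₁ (refl , refl)
  Last-∷⁻ (cons l) = inj₂ l

  Last⇒∈ : ∀ {xs a} → Last xs a → a ∈ xs
  Last⇒∈ single   = here refl
  Last⇒∈ (cons l) = there (Last⇒∈ l)

  Head⇒∈ : ∀ {xs b} → Head xs b → b ∈ xs
  Head⇒∈ {x ∷ _} h = here (sym h)

  CyclicConsec⇒∈ : ∀ {xs a b} → CyclicConsec xs a b → a ∈ xs
  CyclicConsec⇒∈ (inj₁ here)      = here refl
  CyclicConsec⇒∈ (inj₁ (there c)) = there (CyclicConsec⇒∈ (inj₁ c))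
  CyclicConsec⇒∈ (inj₂ (l , _))   = Last⇒∈ l

module _ {A B : Set} (g : A → B) where

  unique-map⁺ : ∀ {xs} → Unique xs → (∀ {a b} → a ∈ xs → b ∈ xs → g a ≡ g b → a ≡ b) → Unique (map g xs)
  unique-map⁺ []          _   = []
  unique-map⁺ (x∉ ∷ uniq) inj =
    Allₚ.map⁺ (All.tabulate (λ {b} b∈ gx≡gb → All.lookup x∉ b∈ (inj (here refl) (there b∈) gx≡gb)))
    ∷ unique-map⁺ uniq (λ a∈ b∈ → inj (there a∈) (there b∈))

  Consec-map⁻ : ∀ {xs u w} → Consec (map g xs) u w → ∃ λ a → ∃ λ b → Consec xs a b × g a ≡ u × g b ≡ w
  Consec-map⁻ {_ ∷ _ ∷ _} here = _ , _ , here , refl , refl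
  Consec-map⁻ {_ ∷ _}     (there c) with Consec-map⁻ c
  ... | a , b , c′ , p , q = a , b , there c′ , p , q

  Last-map⁻ : ∀ {xs u} → Last (map g xs) u → ∃ λ a → Last xs a × g a ≡ u
  Last-map⁻ {_ ∷ []} single   = _ , single , refl
  Last-map⁻ {_ ∷ _}  (cons l) with Last-map⁻ l
  ... | a , l′ , p = a , cons l′ , p

  Head-map⁻ : ∀ {xs w} → Head (map g xs) w → ∃ λ b → Head xs b × g b ≡ w
  Head-map⁻ {_ ∷ _} h = _ , refl , h

  CyclicConsec-map⁻ : ∀ {xs u w} → CyclicConsec (map g xs) u w →
                      ∃ λ a → ∃ λ b → CyclicConsec xs a b × g a ≡ u × g b ≡ w
  CyclicConsec-map⁻ (inj₁ c) with Consec-map⁻ c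
  ... | a , b , c′ , p , q = a , b , inj₁ c′ , p , q
  CyclicConsec-map⁻ (inj₂ (l , h)) with Last-map⁻ l | Head-map⁻ h
  ... | a , l′ , p | b , h′ , q = a , b , inj₂ (l′ , h′) , p , q

next-last : ∀ {k} (i : Fin (suc k)) → k ≡ toℕ i → next i ≡ Fin.zero
next-last {k} i e with k ℕ.≟ toℕ i
... | yes _ = refl
... | no ne = ⊥-elim (ne e)

toℕ-next : ∀ {k} (i : Fin (suc k)) → k ≢ toℕ i → toℕ (next i) ≡ suc (toℕ i)
toℕ-next {k} i ne with k ℕ.≟ toℕ i
... | yes e   = ⊥-elim (ne e)
... | no ne′ = cong suc (Finₚ.toℕ-lower₁ i ne′)

module _ {V : Set} {R : V → V → Set} where

  listCycle : (xs : List V) → 3 ≤ length xs → Unique xs → (∀ a b → CyclicConsec xs a b → R a b) →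
              Σ (Cycle V R) λ C → (∀ x → x ∈ xs → OnCycle C x) × (∀ a b → CyclicConsec xs a b → CycleEdge C a b)
  listCycle xs@(_ ∷ _ ∷ _ ∷ ys) _ uniq rel = C , (λ x x∈ → index x∈ , sym (lookup-index x∈)) , edge
    where
      k = 2 + length ys

      step : ∀ i → R (lookup xs i) (lookup xs (next i))
      step i = step′ i (k ℕ.≟ toℕ i)
        where
        step′ : ∀ i → Dec (k ≡ toℕ i) → R (lookup xs i) (lookup xs (next i))
        step′ i (yes e) = subst (λ j → R (lookup xs i) (lookup xs j)) (sym (next-last i e))
                          (rel _ _ (inj₂ (Last-lookup xs i (cong suc (sym e)) , refl)))
        step′ i (no ne) = rel _ _ (inj₁ (Consec-lookup xs i (next i) (toℕ-next i ne)))

      C : Cycle V R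
      C = record { m = length ys ; vtx = lookup xs ; inj = lookup-injective uniq _ _ ; step = step }

      edge : ∀ a b → CyclicConsec xs a b → CycleEdge C a b
      edge a b (inj₁ c) with lookup-Consec c
      ... | i , j , e , p , q = i , inj₁ (p , trans (cong (lookup xs) next-i) q)
        where
          i≢last : k ≢ toℕ i
          i≢last k≡i = ℕₚ.<-irrefl refl (subst (_< 3 + length ys) (trans e (cong suc (sym k≡i))) (Finₚ.toℕ<n j))
          next-i : next i ≡ j
          next-i = Finₚ.toℕ-injective (trans (toℕ-next i i≢last) (sym e))
      edge a b (inj₂ (l , h)) with lookup-Last l
      ... | i , e , p = i , inj₁ (p , trans (cong (lookup xs) (next-last i (ℕₚ.suc-injective (sym e)))) h)
  listCycle (_ ∷ [])     (s≤s ())     _ _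
  listCycle (_ ∷ _ ∷ []) (s≤s (s≤s ())) _ _

  CycleEdge-sym : ∀ {C : Cycle V R} {a b} → CycleEdge C a b → CycleEdge C b a
  CycleEdge-sym (i , inj₁ p) = i , inj₂ p
  CycleEdge-sym (i , inj₂ p) = i , inj₁ p

module _ {L : ℕ} .{{_ : NonZero L}} where

  %-congˡ-+ : ∀ c {a b} → a % L ≡ b % L → (c + a) % L ≡ (c + b) % L
  %-congˡ-+ c {a} {b} e = begin
    (c + a) % L           ≡⟨ %-distribˡ-+ c a L ⟩
    (c % L + a % L) % L   ≡⟨ cong (λ z → (c % L + z) % L) e ⟩
    (c % L + b % L) % L   ≡⟨ %-distribˡ-+ c b L ⟨
    (c + b) % L           ∎
    where open ≡-Reasoning

  %-injective-< : ∀ {a b} → a < L → b < L → a % L ≡ b % L → a ≡ b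
  %-injective-< a<L b<L e = trans (sym (m<n⇒m%n≡m a<L)) (trans e (m<n⇒m%n≡m b<L))

%-cancel-suc : ∀ {L} .{{_ : NonZero L}} {a b} → suc a % L ≡ suc b % L → a % L ≡ b % L
%-cancel-suc {suc L′} {a} {b} e = begin
  a % L                ≡⟨ [m+n]%n≡m%n a L ⟨
  (a + L) % L          ≡⟨ cong (_% L) (wrap a) ⟩
  (L′ + suc a) % L     ≡⟨ %-congˡ-+ L′ e ⟩
  (L′ + suc b) % L     ≡⟨ cong (_% L) (wrap b) ⟨
  (b + L) % L          ≡⟨ [m+n]%n≡m%n b L ⟩
  b % L                ∎
  where
  open ≡-Reasoning
  L = suc L′
  wrap : ∀ x → x + L ≡ L′ + suc x
  wrap x = trans (ℕₚ.+-comm x L) (sym (ℕₚ.+-suc L′ x))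

%-cancelˡ-+ : ∀ {L} .{{_ : NonZero L}} c {a b} → (c + a) % L ≡ (c + b) % L → a % L ≡ b % L
%-cancelˡ-+ zero    e = e
%-cancelˡ-+ (suc c) e = %-cancelˡ-+ c (%-cancel-suc e)

+-%-≢ : ∀ {L} .{{_ : NonZero L}} i {d} → 0 < d → d < L → (i + d) % L ≢ i % L
+-%-≢ {L} i {d} 0<d d<L e = ℕₚ.<⇒≢ 0<d (sym (%-injective-< d<L (ℕₚ.<-trans 0<d d<L) d≡0))
  where
  d≡0 : d % L ≡ 0 % L
  d≡0 = %-cancelˡ-+ i (trans e (cong (_% L) (sym (ℕₚ.+-identityʳ i))))

toℕ-mod : ∀ {L} .{{_ : NonZero L}} j → toℕ (j mod L) ≡ j % L
toℕ-mod {L} j = Finₚ.toℕ-fromℕ< (m%n<n j L)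

mod-toℕ : ∀ {L} .{{_ : NonZero L}} (i : Fin L) → toℕ i mod L ≡ i
mod-toℕ {L} i = Finₚ.toℕ-injective (trans (toℕ-mod (toℕ i)) (m<n⇒m%n≡m (Finₚ.toℕ<n i)))

mod-cong : ∀ {L} .{{_ : NonZero L}} {a b} → a % L ≡ b % L → a mod L ≡ b mod L
mod-cong {a = a} {b} e = Finₚ.toℕ-injective (trans (toℕ-mod a) (trans e (sym (toℕ-mod b))))

next-mod : ∀ {k} j → next (j mod suc k) ≡ suc j mod suc k
next-mod {k} j = Finₚ.toℕ-injective (trans (toℕ-next-i (k ℕ.≟ toℕ i)) (sym (toℕ-mod (suc j))))
  where
  L = suc k
  i = j mod L

  suc-j : suc j % L ≡ suc (toℕ i) % L
  suc-j = %-congˡ-+ {L} 1 (sym (trans (cong (_% L) (toℕ-mod j)) (m%n%n≡m%n j L)))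

  toℕ-next-i : Dec (k ≡ toℕ i) → toℕ (next i) ≡ suc j % L
  toℕ-next-i (yes e) = begin
    toℕ (next i)       ≡⟨ cong toℕ (next-last i e) ⟩
    0                  ≡⟨ n%n≡0 L ⟨
    L % L              ≡⟨ cong (λ z → suc z % L) e ⟩
    suc (toℕ i) % L    ≡⟨ suc-j ⟨
    suc j % L          ∎
    where open ≡-Reasoning
  toℕ-next-i (no ne) = begin
    toℕ (next i)       ≡⟨ toℕ-next i ne ⟩
    suc (toℕ i)        ≡⟨ m<n⇒m%n≡m (ℕₚ.≤∧≢⇒< (Finₚ.toℕ<n i) (ne ∘ ℕₚ.suc-injective ∘ sym)) ⟨
    suc (toℕ i) % L    ≡⟨ suc-j ⟨
    suc j % L          ∎
    where open ≡-Reasoning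

-- Periodic indexing of a cycle by ℕ

module Periodic {V : Set} {R : V → V → Set} (C : Cycle V R) where
  open Cycle C

  L : ℕ
  L = 3 + m

  at : ℕ → V
  at j = vtx (j mod L)

  abstract
    at-step : ∀ j → R (at j) (at (suc j))
    at-step j = subst (R (at j) ∘ vtx) (next-mod j) (step (j mod L))

  at-injective : ∀ a b → at a ≡ at b → a % L ≡ b % L
  at-injective a b e = trans (sym (toℕ-mod a)) (trans (cong toℕ (inj e)) (toℕ-mod b))

  at-cong : ∀ a b → a % L ≡ b % L → at a ≡ at b
  at-cong a b e = cong vtx (mod-cong {a = a} {b} e)

  suc-%-cong : ∀ a b → a % L ≡ b % L → suc a % L ≡ suc b % L
  suc-%-cong a b = %-congˡ-+ {L} 1 {a} {b}

  suc-%-cancel : ∀ a b → suc a % L ≡ suc b % L → a % L ≡ b % L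
  suc-%-cancel a b = %-cancel-suc {L} {a} {b}

  at-toℕ : ∀ i → at (toℕ i) ≡ vtx i
  at-toℕ i = cong vtx (mod-toℕ i)

  at-suc-toℕ : ∀ i → at (suc (toℕ i)) ≡ vtx (next i)
  at-suc-toℕ i = cong vtx (trans (sym (next-mod (toℕ i))) (cong next (mod-toℕ i)))

  at-onCycle : ∀ {x} → OnCycle C x → ∃ λ j → j < L × at j ≡ x
  at-onCycle (i , e) = toℕ i , Finₚ.toℕ<n i , trans (at-toℕ i) e

  at-cycleEdge : ∀ {a b} → CycleEdge C a b → ∃ λ j → (at j ≡ a × at (suc j) ≡ b) ⊎ (at j ≡ b × at (suc j) ≡ a)
  at-cycleEdge (i , inj₁ (p , q)) = toℕ i , inj₁ (trans (at-toℕ i) p , trans (at-suc-toℕ i) q)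
  at-cycleEdge (i , inj₂ (p , q)) = toℕ i , inj₂ (trans (at-toℕ i) p , trans (at-suc-toℕ i) q)

unique⇒length≤∣p∣ : ∀ {n} (p : Subset n) {xs : List (Fin n)} → Unique xs → All (_∈ₛ p) xs → length xs ≤ ∣ p ∣
unique⇒length≤∣p∣ p []        []            = z≤n
unique⇒length≤∣p∣ p (x∉ ∷ u) (x∈ ∷ xs∈) =
  ℕₚ.<-≤-trans (s≤s (unique⇒length≤∣p∣ (p - _) u (All.zipWith (λ (y∈ , x≢y) → x∈p∧x≢y⇒x∈p-y y∈ (x≢y ∘ sym)) (xs∈ , x∉))))
               (x∈p⇒∣p-x∣<∣p∣ x∈)

module Edges {n : ℕ} (G : Graph n) where
  open Graph G using (adj; irrefl) renaming (sym to adj-sym)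

  E : Set
  E = GEdge G

  Inc : Fin n → E → Set
  Inc = Incident G

  Adj⇒≢ : ∀ {u v} → Adj G u v → u ≢ v
  Adj⇒≢ {u} p refl with () ← trans (sym p) (irrefl u)

  Adj-irrelevant : ∀ {u v} (p q : Adj G u v) → p ≡ q
  Adj-irrelevant = UIP.Decidable⇒UIP.≡-irrelevant _≟_

  ≡-edge : ∀ {a b a′ b′} (lt : a Fin.< b) (ad : Adj G a b) (lt′ : a′ Fin.< b′) (ad′ : Adj G a′ b′) →
           a ≡ a′ → b ≡ b′ → ((a , b) , lt , ad) ≡ ((a′ , b′) , lt′ , ad′)
  ≡-edge lt ad lt′ ad′ refl refl = cong₂ (λ p q → (_ , p , q)) (Finₚ.<-irrelevant lt lt′) (Adj-irrelevant ad ad′)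

  _≟ᴱ_ : (e f : E) → Dec (e ≡ f)
  ((a , b) , lt , ad) ≟ᴱ ((a′ , b′) , lt′ , ad′) with a Fin.≟ a′ | b Fin.≟ b′
  ... | yes p | yes q = yes (≡-edge lt ad lt′ ad′ p q)
  ... | no ¬p | _     = no (¬p ∘ cong (proj₁ ∘ proj₁))
  ... | yes _ | no ¬q = no (¬q ∘ cong (proj₂ ∘ proj₁))

  Inc? : ∀ z e → Dec (Inc z e)
  Inc? z ((a , b) , _) with z Fin.≟ a | z Fin.≟ b
  ... | yes p | _     = yes (inj₁ p)
  ... | no _  | yes q = yes (inj₂ q)
  ... | no ¬p | no ¬q = no λ { (inj₁ p) → ¬p p ; (inj₂ q) → ¬q q }

  ends : ∀ {u w} (e : E) → u ≢ w → Inc u e → Inc w e →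
         (u ≡ proj₁ (proj₁ e) × w ≡ proj₂ (proj₁ e)) ⊎ (u ≡ proj₂ (proj₁ e) × w ≡ proj₁ (proj₁ e))
  ends e u≢w (inj₁ p) (inj₁ q) = ⊥-elim (u≢w (trans p (sym q)))
  ends e u≢w (inj₁ p) (inj₂ q) = inj₁ (p , q)
  ends e u≢w (inj₂ p) (inj₁ q) = inj₂ (p , q)
  ends e u≢w (inj₂ p) (inj₂ q) = ⊥-elim (u≢w (trans p (sym q)))

  ends-injective : ∀ {u w} (e f : E) → u ≢ w → Inc u e → Inc w e → Inc u f → Inc w f → e ≡ f
  ends-injective e@((a , b) , lt , ad) f@((a′ , b′) , lt′ , ad′) u≢w ue we uf wf
    with ends e u≢w ue we | ends f u≢w uf wf
  ... | inj₁ (p , q) | inj₁ (p′ , q′) = ≡-edge lt ad lt′ ad′ (trans (sym p) p′) (trans (sym q) q′)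
  ... | inj₂ (p , q) | inj₂ (p′ , q′) = ≡-edge lt ad lt′ ad′ (trans (sym q) q′) (trans (sym p) p′)
  ... | inj₁ (p , q) | inj₂ (p′ , q′) = ⊥-elim (Finₚ.<-asym lt (subst₂ Fin._<_ (trans (sym q′) q) (trans (sym p′) p) lt′))
  ... | inj₂ (p , q) | inj₁ (p′ , q′) = ⊥-elim (Finₚ.<-asym lt (subst₂ Fin._<_ (trans (sym p′) p) (trans (sym q′) q) lt′))

  common-end-unique : ∀ {u w} (e f : E) → e ≢ f → Inc u e → Inc u f → Inc w e → Inc w f → u ≡ w
  common-end-unique {u} {w} e f e≢f ue uf we wf with u Fin.≟ w
  ... | yes u≡w = u≡w
  ... | no  u≢w = ⊥-elim (e≢f (ends-injective e f u≢w ue we uf wf))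

  ends⇒Adj : ∀ {u w} (e : E) → Inc u e → Inc w e → u ≢ w → Adj G u w
  ends⇒Adj {u} {w} e@((a , b) , _ , ad) ue we u≢w with ends e u≢w ue we
  ... | inj₁ (refl , refl) = ad
  ... | inj₂ (refl , refl) = trans (adj-sym b a) ad

  edge : ∀ u v → Adj G u v → E
  edge u v p with Finₚ.<-cmp u v
  ... | tri< lt _ _ = (u , v) , lt , p
  ... | tri≈ _ u≡v _ = ⊥-elim (Adj⇒≢ p u≡v)
  ... | tri> _ _ gt = (v , u) , gt , trans (adj-sym v u) p

  edge-ends : ∀ u v (p : Adj G u v) → Inc u (edge u v p) × Inc v (edge u v p)
  edge-ends u v p with Finₚ.<-cmp u v
  ... | tri< _ _ _ = inj₁ refl , inj₂ refl
  ... | tri≈ _ u≡v _ = ⊥-elim (Adj⇒≢ p u≡v)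
  ... | tri> _ _ _ = inj₂ refl , inj₁ refl

  edge-ends⁻ : ∀ {z} u v (p : Adj G u v) → Inc z (edge u v p) → z ≡ u ⊎ z ≡ v
  edge-ends⁻ u v p i with Finₚ.<-cmp u v | i
  ... | tri< _ _ _   | inj₁ z≡u = inj₁ z≡u
  ... | tri< _ _ _   | inj₂ z≡v = inj₂ z≡v
  ... | tri≈ _ u≡v _ | _        = ⊥-elim (Adj⇒≢ p u≡v)
  ... | tri> _ _ _   | inj₁ z≡v = inj₂ z≡v
  ... | tri> _ _ _   | inj₂ z≡u = inj₁ z≡u

  other : ∀ {v} (e : E) → Inc v e → Fin n
  other ((_ , b) , _) (inj₁ _) = b
  other ((a , _) , _) (inj₂ _) = a

  Adj-other : ∀ {v} e (i : Inc v e) → Adj G v (other e i)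
  Adj-other (_ , _ , ad) (inj₁ refl) = ad
  Adj-other ((a , b) , _ , ad) (inj₂ refl) = trans (adj-sym b a) ad

  Inc-other : ∀ {v} e (i : Inc v e) → Inc (other e i) e
  Inc-other _ (inj₁ _) = inj₂ refl
  Inc-other _ (inj₂ _) = inj₁ refl

  neighbours : ∀ {v} {es : List E} → All (Inc v) es → List (Fin n)
  neighbours []                    = []
  neighbours {es = e ∷ _} (i ∷ is) = other e i ∷ neighbours is

  length-neighbours : ∀ {v} {es : List E} (is : All (Inc v) es) → length (neighbours is) ≡ length es
  length-neighbours []       = refl
  length-neighbours (_ ∷ is) = cong suc (length-neighbours is)

  neighbours-adjacent : ∀ {v} {es : List E} (is : All (Inc v) es) → All (Adj G v) (neighbours is)
  neighbours-adjacent []                    = []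
  neighbours-adjacent {es = e ∷ _} (i ∷ is) = Adj-other e i ∷ neighbours-adjacent is

  neighbours-unique : ∀ {v} {es : List E} (is : All (Inc v) es) → Unique es → Unique (neighbours is)
  neighbours-unique []                    []          = []
  neighbours-unique {es = e ∷ _} (i ∷ is) (e∉ ∷ uniq) = distinct is e∉ ∷ neighbours-unique is uniq
    where
    distinct : ∀ {fs} (js : All (Inc _) fs) → All (e ≢_) fs → All (other e i ≢_) (neighbours js)
    distinct []               []         = []
    distinct {f ∷ _} (j ∷ js) (e≢f ∷ e∉) = w≢w′ ∷ distinct js e∉
      where
      w≢w′ : other e i ≢ other f j
      w≢w′ w≡w′ = e≢f (ends-injective e f (Adj⇒≢ (Adj-other e i)) i (Inc-other e i)
                                      j (subst (λ w → Inc w f) (sym w≡w′) (Inc-other f j)))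

  incident-edges≤degree : ∀ {v} {es : List E} → Unique es → All (Inc v) es → length es ≤ degree G v
  incident-edges≤degree {v} uniq is =
    subst (_≤ degree G v) (length-neighbours is)
          (unique⇒length≤∣p∣ (tabulate (adj v)) (neighbours-unique is uniq) (All.map ∈-tabulate (neighbours-adjacent is)))
    where
    ∈-tabulate : ∀ {w} → Adj G v w → w ∈ₛ tabulate (adj v)
    ∈-tabulate {w} a = lookup⇒[]= w _ (trans (lookup∘tabulate (adj v) w) a)

  ¬4-incident-edges : MaxDegree≤ G 3 → ∀ {v e₁ e₂ e₃ e₄} →
                      Unique (e₁ ∷ e₂ ∷ e₃ ∷ e₄ ∷ []) → All (Inc v) (e₁ ∷ e₂ ∷ e₃ ∷ e₄ ∷ []) → ⊥
  ¬4-incident-edges Δ≤3 {v} uniq is with ℕₚ.≤-trans (incident-edges≤degree uniq is) (Δ≤3 v)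
  ... | s≤s (s≤s (s≤s ()))

select : (ℕ → Bool) → ℕ → ℕ → List ℕ
select p s zero    = []
select p s (suc c) with p s
... | true  = s ∷ select p (suc s) c
... | false = select p (suc s) c

module _ (p : ℕ → Bool) where

  private
    shift : ∀ s c {j} → suc s ≤ j × j < suc s + c → s ≤ j × j < s + suc c
    shift s c {j} (s<j , j<) = ℕₚ.<⇒≤ s<j , subst (j <_) (sym (ℕₚ.+-suc s c)) j<

    unshift : ∀ s c {j} → s ≢ j → s ≤ j → j < s + suc c → suc s ≤ j × j < suc s + c
    unshift s c {j} s≢j s≤j j< = ℕₚ.≤∧≢⇒< s≤j s≢j , subst (j <_) (ℕₚ.+-suc s c) j<

  ∈-select⁻ : ∀ s c {j} → j ∈ select p s c → (s ≤ j × j < s + c) × p j ≡ true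
  ∈-select⁻ s (suc c) j∈ with p s in ps
  ∈-select⁻ s (suc c) (here refl) | true = (ℕₚ.≤-refl , ℕₚ.m<m+n s (s≤s z≤n)) , ps
  ∈-select⁻ s (suc c) (there j∈) | true with ∈-select⁻ (suc s) c j∈
  ... | range , pj = shift s c range , pj
  ∈-select⁻ s (suc c) j∈ | false with ∈-select⁻ (suc s) c j∈
  ... | range , pj = shift s c range , pj

  ∈-select⁺ : ∀ s c {j} → s ≤ j → j < s + c → p j ≡ true → j ∈ select p s c
  ∈-select⁺ s zero    s≤j j< _ = ⊥-elim (ℕₚ.<-irrefl refl (ℕₚ.≤-trans j< (subst (_≤ _) (sym (ℕₚ.+-identityʳ s)) s≤j)))
  ∈-select⁺ s (suc c) {j} s≤j j< pj with s ℕ.≟ j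
  ∈-select⁺ s (suc c) s≤j j< pj | yes refl rewrite pj = here refl
  ... | no s≢j with p s | unshift s c s≢j s≤j j<
  ... | true  | s<j , j<′ = there (∈-select⁺ (suc s) c s<j j<′ pj)
  ... | false | s<j , j<′ = ∈-select⁺ (suc s) c s<j j<′ pj

  Head-select : ∀ s c {b} → Head (select p s c) b → ∀ j → s ≤ j → j < b → p j ≡ false
  Head-select s (suc c) {b} h j s≤j j<b with p s in ps | s ℕ.≟ j
  ... | true  | _        = ⊥-elim (ℕₚ.<-irrefl h (ℕₚ.≤-<-trans s≤j j<b))
  ... | false | yes refl = ps
  ... | false | no s≢j   = Head-select (suc s) c h j (ℕₚ.≤∧≢⇒< s≤j s≢j) j<b

  Last-select : ∀ s c {a} → Last (select p s c) a → ∀ j → a < j → j < s + c → p j ≡ false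
  Last-select s (suc c) {a} l j a<j j< with p s
  ... | false = Last-select (suc s) c l j a<j (subst (j <_) (ℕₚ.+-suc s c) j<)
  ... | true with Last-∷⁻ l
  ... | inj₂ l′ = Last-select (suc s) c l′ j a<j (subst (j <_) (ℕₚ.+-suc s c) j<)
  ... | inj₁ (rest≡[] , refl) with p j in pj
  ...   | false = refl
  ...   | true with () ← subst (j ∈_) rest≡[] (∈-select⁺ (suc s) c a<j (subst (j <_) (ℕₚ.+-suc s c) j<) pj)

  Consec-select : ∀ s c {a b} → Consec (select p s c) a b → a < b × (∀ j → a < j → j < b → p j ≡ false)
  Consec-select s (suc c) c′ with p s
  ... | false = Consec-select (suc s) c c′
  ... | true with Consec-∷⁻ c′
  ... | inj₂ c″ = Consec-select (suc s) c c″
  ... | inj₁ (refl , h) = proj₁ (proj₁ (∈-select⁻ (suc s) c (Head⇒∈ h))) , Head-select (suc s) c h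

  select-unique : ∀ s c → Unique (select p s c)
  select-unique s zero = []
  select-unique s (suc c) with p s
  ... | false = select-unique (suc s) c
  ... | true  = All.tabulate (λ j∈ s≡j → ℕₚ.<-irrefl s≡j (proj₁ (proj₁ (∈-select⁻ (suc s) c j∈))))
                ∷ select-unique (suc s) c

module _ (σ : Fin 3 → Fin 3) (σσi≡i : ∀ i → σ (σ i) ≡ i) where

  private
    orbit : ∀ i {j k} → σ i ≡ j → σ j ≡ k → k ≢ i → ⊥
    orbit i refl refl k≢i = k≢i (σσi≡i i)

  involution-Fin3-has-fixpoint : ¬ (∀ i → σ i ≢ i)
  involution-Fin3-has-fixpoint σi≢i with σ 0F in e0 | σ 1F in e1 | σ 2F in e2
  ... | 0F | _  | _  = σi≢i 0F e0
  ... | _  | 1F | _  = σi≢i 1F e1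
  ... | _  | _  | 2F = σi≢i 2F e2
  ... | 1F | 0F | 0F = orbit 2F e2 e0 λ ()
  ... | 1F | 0F | 1F = orbit 2F e2 e1 λ ()
  ... | 1F | 2F | _  = orbit 0F e0 e1 λ ()
  ... | 2F | 0F | 0F = orbit 1F e1 e0 λ ()
  ... | 2F | _  | 1F = orbit 0F e0 e2 λ ()
  ... | 2F | 2F | 0F = orbit 1F e1 e2 λ ()

module Partner {n : ℕ} {G : Graph n} (PM : PerfectMatching G) where
  open PerfectMatching PM public

  partner : GEdge G → GEdge G
  partner e = proj₁ (M-perf e)

  M-partner : ∀ e → M e (partner e)
  M-partner e = proj₁ (proj₂ (M-perf e))

  partner-unique : ∀ e g → M e g → g ≡ partner e
  partner-unique e = proj₂ (proj₂ (M-perf e))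

  partner-involutive : ∀ e → partner (partner e) ≡ e
  partner-involutive e = sym (partner-unique (partner e) e (M-sym e (partner e) (M-partner e)))

  partner-M : ∀ {e g} → partner g ≡ e → M e g
  partner-M {g = g} refl = M-sym _ _ (M-partner g)

  partner≢ : ∀ e → partner e ≢ e
  partner≢ e p≡e = proj₁ (M-edge e (partner e) (M-partner e)) (sym p≡e)

-- From a hamiltonian cycle of L(G) through M to a dominating cycle of G

module FromHamiltonian {n : ℕ} (G : Graph n) (Δ≤3 : MaxDegree≤ G 3) (PM : PerfectMatching G)
                       (H : LineCycle G) (ham : Hamiltonian H)
                       (M⊆H : ∀ e f → PerfectMatching.M PM e f → CycleEdge H e f) where
  open Edges G
  open Periodic H
  open Partner PM

  -- at j and at (suc j) are distinct edges sharing the vertex turn j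
  turn : ℕ → Fin n
  turn j = proj₁ (proj₂ (at-step j))

  turn-inc : ∀ j → Inc (turn j) (at j)
  turn-inc j = proj₁ (proj₂ (proj₂ (at-step j)))

  turn-inc-suc : ∀ j → Inc (turn j) (at (suc j))
  turn-inc-suc j = proj₂ (proj₂ (proj₂ (at-step j)))

  at-suc-≢ : ∀ j → at j ≢ at (suc j)
  at-suc-≢ j = proj₁ (at-step j)

  turn-cong : ∀ a b → a % L ≡ b % L → turn a ≡ turn b
  turn-cong a b e = common-end-unique (at a) (at (suc a)) (at-suc-≢ a) (turn-inc a) (turn-inc-suc a)
                      (subst (Inc (turn b)) (at-cong b a (sym e)) (turn-inc b))
                      (subst (Inc (turn b)) (at-cong (suc b) (suc a) (suc-%-cong b a (sym e))) (turn-inc-suc b))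

  moves : ℕ → Bool
  moves j = not (does (turn j Fin.≟ turn (suc j)))

  moves⇒≢ : ∀ {j} → moves j ≡ true → turn j ≢ turn (suc j)
  moves⇒≢ {j} mv with turn j Fin.≟ turn (suc j)
  moves⇒≢ () | yes _
  ... | no ≢ = ≢

  stays⇒≡ : ∀ {j} → moves j ≡ false → turn j ≡ turn (suc j)
  stays⇒≡ {j} st with turn j Fin.≟ turn (suc j)
  ... | yes ≡ = ≡
  stays⇒≡ () | no _

  moves-cong : ∀ a b → a % L ≡ b % L → moves a ≡ moves b
  moves-cong a b e = cong₂ (λ u w → not (does (u Fin.≟ w))) (turn-cong a b e) (turn-cong (suc a) (suc b) (suc-%-cong a b e))

  turn-constant : ∀ a b → a ≤ b → (∀ j → a ≤ j → j < b → moves j ≡ false) → turn a ≡ turn b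
  turn-constant a zero    z≤n _     = refl
  turn-constant a (suc b) a≤b still with a ℕ.≟ suc b
  ... | yes refl = refl
  ... | no  a≢b  = trans (turn-constant a b a≤b′ (λ j a≤j j<b → still j a≤j (ℕₚ.m<n⇒m<1+n j<b)))
                         (stays⇒≡ (still b a≤b′ ℕₚ.≤-refl))
    where a≤b′ = ℕ.s≤s⁻¹ (ℕₚ.≤∧≢⇒< a≤b a≢b)

  moveList : List ℕ
  moveList = select moves 0 L

  corners : List (Fin n)
  corners = map turn moveList

  ∈-moveList⁻ : ∀ {a} → a ∈ moveList → a < L × moves a ≡ true
  ∈-moveList⁻ a∈ with ∈-select⁻ moves 0 L a∈
  ... | (_ , a<L) , mv = a<L , mv

  turn-next-move : ∀ {a b} → CyclicConsec moveList a b → turn (suc a) ≡ turn b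
  turn-next-move (inj₁ c) with Consec-select moves 0 L c
  ... | a<b , still = turn-constant _ _ a<b still
  turn-next-move {a} {b} (inj₂ (l , h)) = begin
    turn (suc a) ≡⟨ turn-constant (suc a) L (proj₁ (∈-moveList⁻ (Last⇒∈ l))) (Last-select moves 0 L l) ⟩
    turn L       ≡⟨ turn-cong L 0 (n%n≡0 L) ⟩
    turn 0       ≡⟨ turn-constant 0 b z≤n (Head-select moves 0 L h) ⟩
    turn b       ∎
    where open ≡-Reasoning

  move-corner : ∀ {k} → moves k ≡ true → turn k ∈ corners
  move-corner {k} mv =
    subst (_∈ corners) (turn-cong (k % L) k (m%n%n≡m%n k L))
          (∈-map⁺ turn (∈-select⁺ moves 0 L z≤n (m%n<n k L) (trans (moves-cong (k % L) k (m%n%n≡m%n k L)) mv)))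

  -- Walking forward from j, the turning vertex stays turn j until the first move, which is a corner.
  turn-∈-corners : ∀ {t} → t ∈ moveList → ∀ j → turn j ∈ corners
  turn-∈-corners {t} t∈ j with walk (t + j * (L ∸ 1))
    where
    walk : ∀ d → turn j ∈ corners ⊎ turn (d + j) ≡ turn j
    walk zero = inj₂ refl
    walk (suc d) with walk d | moves (d + j) in mv
    ... | inj₁ c  | _     = inj₁ c
    ... | inj₂ eq | false = inj₂ (trans (sym (stays⇒≡ mv)) eq)
    ... | inj₂ eq | true  = inj₁ (subst (_∈ corners) eq (move-corner mv))
  ... | inj₁ c  = c
  ... | inj₂ eq = subst (_∈ corners) (trans (turn-cong t _ t≡) (trans (cong turn (sym (ℕₚ.+-assoc t _ j))) eq)) (move-corner (proj₂ (∈-moveList⁻ t∈)))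
    where
    t≡ : t % L ≡ (t + (j * (L ∸ 1) + j)) % L
    t≡ = sym (trans (cong (λ z → (t + z) % L) j*L) ([m+kn]%n≡m%n t j L))
      where j*L = trans (ℕₚ.+-comm (j * (L ∸ 1)) j) (sym (ℕₚ.*-suc j (L ∸ 1)))

  at-≢ : ∀ {a b} → a < L → b < L → a ≢ b → at a ≢ at b
  at-≢ {a} {b} a<L b<L a≢b = a≢b ∘ %-injective-< a<L b<L ∘ at-injective a b

  -- Two distinct moves at the same vertex would put four edges on it.
  corners-unique : Unique corners
  corners-unique = unique-map⁺ turn (select-unique moves 0 L) distinct
    where
    distinct : ∀ {a b} → a ∈ moveList → b ∈ moveList → turn a ≡ turn b → a ≡ b
    distinct {a} {b} a∈ b∈ ta≡tb with a ℕ.≟ b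
    ... | yes a≡b = a≡b
    ... | no  a≢b = ⊥-elim (¬4-incident-edges Δ≤3
            ( (at-suc-≢ a ∷ at-≢ a<L b<L a≢b ∷ a≢sb ∷ [])
            ∷ (sa≢b ∷ (a≢b ∘ %-injective-< a<L b<L ∘ suc-%-cancel a b ∘ at-injective (suc a) (suc b)) ∷ [])
            ∷ (at-suc-≢ b ∷ []) ∷ [] ∷ [])
            (turn-inc a ∷ turn-inc-suc a ∷ subst (λ v → Inc v (at b)) (sym ta≡tb) (turn-inc b)
                      ∷ subst (λ v → Inc v (at (suc b))) (sym ta≡tb) (turn-inc-suc b) ∷ []))
      where
      a<L = proj₁ (∈-moveList⁻ a∈)
      b<L = proj₁ (∈-moveList⁻ b∈)
      a≢sb : at a ≢ at (suc b)
      a≢sb e = moves⇒≢ (proj₂ (∈-moveList⁻ b∈)) (trans (sym ta≡tb) (turn-cong a (suc b) (at-injective a (suc b) e)))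
      sa≢b : at (suc a) ≢ at b
      sa≢b e = moves⇒≢ (proj₂ (∈-moveList⁻ a∈)) (trans ta≡tb (sym (turn-cong (suc a) b (at-injective (suc a) b e))))

  -- The partner map, read on the positions of H, is a fixed-point-free involution.
  length≢3 : Cycle.m H ≢ 0
  length≢3 m≡0 = on-Fin3 (cong (3 +_) m≡0) σ σσi≡i σi≢i
    where
    on-Fin3 : ∀ {k} → k ≡ 3 → (σ : Fin k → Fin k) → (∀ i → σ (σ i) ≡ i) → ¬ (∀ i → σ i ≢ i)
    on-Fin3 refl = involution-Fin3-has-fixpoint
    open Cycle H using (vtx; inj)
    σ : Fin L → Fin L
    σ i = proj₁ (ham (partner (vtx i)))
    vtx-σ : ∀ i → vtx (σ i) ≡ partner (vtx i)
    vtx-σ i = proj₂ (ham (partner (vtx i)))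
    σσi≡i : ∀ i → σ (σ i) ≡ i
    σσi≡i i = inj (trans (vtx-σ (σ i)) (trans (cong partner (vtx-σ i)) (partner-involutive (vtx i))))
    σi≢i : ∀ i → σ i ≢ i
    σi≢i i σi≡i = partner≢ (vtx i) (trans (sym (vtx-σ i)) (cong vtx σi≡i))

  no-moves : moveList ≢ []
  no-moves none = ¬4-incident-edges Δ≤3
      ( (at-≢ 0<L 1<L (λ ()) ∷ at-≢ 0<L 2<L (λ ()) ∷ at-≢ 0<L 3<L (λ ()) ∷ [])
      ∷ (at-≢ 1<L 2<L (λ ()) ∷ at-≢ 1<L 3<L (λ ()) ∷ [])
      ∷ (at-≢ 2<L 3<L (λ ()) ∷ []) ∷ [] ∷ [])
      (at-turn0 0<L ∷ at-turn0 1<L ∷ at-turn0 2<L ∷ at-turn0 3<L ∷ [])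
    where
    0<L : 0 < L
    0<L = s≤s z≤n
    1<L : 1 < L
    1<L = s≤s (s≤s z≤n)
    2<L : 2 < L
    2<L = s≤s (s≤s (s≤s z≤n))
    3<L : 3 < L
    3<L = s≤s (s≤s (s≤s (ℕₚ.n≢0⇒n>0 length≢3)))
    still : ∀ j → j < L → moves j ≡ false
    still j j<L with moves j in mv
    ... | false = refl
    ... | true with () ← subst (j ∈_) none (∈-select⁺ moves 0 L z≤n j<L mv)
    at-turn0 : ∀ {j} → j < L → Inc (turn 0) (at j)
    at-turn0 {j} j<L = subst (λ v → Inc v (at j)) (sym (turn-constant 0 j z≤n (λ i _ i<j → still i (ℕₚ.<-trans i<j j<L))))
                             (turn-inc j)

  one-move : ∀ {a} → moveList ≢ a ∷ []
  one-move {a} only = moves⇒≢ (proj₂ (∈-moveList⁻ (subst (a ∈_) (sym only) (here refl))))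
                              (sym (turn-next-move (subst (λ l → CyclicConsec l a a) (sym only) (inj₂ (single , refl)))))

  two-moves : ∀ {a b} → moveList ≢ a ∷ b ∷ []
  two-moves {a} {b} two = a≢b (%-injective-< a<L b<L (suc-%-cancel a b (at-injective (suc a) (suc b) sa≡sb)))
    where
    a∈ = subst (a ∈_) (sym two) (here refl)
    b∈ = subst (b ∈_) (sym two) (there (here refl))
    a<L = proj₁ (∈-moveList⁻ a∈)
    b<L = proj₁ (∈-moveList⁻ b∈)
    a≢b : a ≢ b
    a≢b = ℕₚ.<⇒≢ (proj₁ (Consec-select moves 0 L (subst (λ l → Consec l a b) (sym two) here)))
    ta≡tb : turn (suc a) ≡ turn b
    ta≡tb = turn-next-move (subst (λ l → CyclicConsec l a b) (sym two) (inj₁ here))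
    tb≡ta : turn (suc b) ≡ turn a
    tb≡ta = turn-next-move (subst (λ l → CyclicConsec l b a) (sym two) (inj₂ (cons single , refl)))
    -- at (suc a) and at (suc b) both join turn a to turn b.
    sa≡sb : at (suc a) ≡ at (suc b)
    sa≡sb = ends-injective (at (suc a)) (at (suc b)) (moves⇒≢ (proj₂ (∈-moveList⁻ a∈)) ∘ (λ e → trans e (sym ta≡tb)))
              (turn-inc-suc a) (subst (λ v → Inc v (at (suc a))) ta≡tb (turn-inc (suc a)))
              (subst (λ v → Inc v (at (suc b))) tb≡ta (turn-inc (suc b))) (turn-inc-suc b)

  three≤moves : 3 ≤ length moveList
  three≤moves with moveList in ml
  ... | []            = ⊥-elim (no-moves ml)
  ... | _ ∷ []        = ⊥-elim (one-move ml)
  ... | _ ∷ _ ∷ []    = ⊥-elim (two-moves ml)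
  ... | _ ∷ _ ∷ _ ∷ _ = s≤s (s≤s (s≤s z≤n))

  cornerCycle : Σ (Cycle (Fin n) (Adj G)) λ D →
                  (∀ x → x ∈ corners → OnCycle D x) × (∀ a b → CyclicConsec corners a b → CycleEdge D a b)
  cornerCycle = listCycle corners (subst (3 ≤_) (sym (Listₚ.length-map turn moveList)) three≤moves) corners-unique adjacent
    where
    adjacent : ∀ u w → CyclicConsec corners u w → Adj G u w
    adjacent u w cc with CyclicConsec-map⁻ turn cc
    ... | a , b , c , refl , refl =
      subst (Adj G (turn a)) (turn-next-move c)
            (ends⇒Adj (at (suc a)) (turn-inc-suc a) (turn-inc (suc a)) (moves⇒≢ (proj₂ (∈-moveList⁻ (CyclicConsec⇒∈ c)))))

  D : Cycle (Fin n) (Adj G)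
  D = proj₁ cornerCycle

  turn-onD : ∀ j → OnCycle D (turn j)
  turn-onD j = proj₁ (proj₂ cornerCycle) (turn j) (turn-∈-corners (proj₂ a-move) j)
    where
    a-move : ∃ (_∈ moveList)
    a-move with moveList | three≤moves
    ... | t ∷ _ | _ = t , here refl

  D-dominating : Dominating G D
  D-dominating u v uv with at-onCycle (ham (edge u v uv))
  ... | j , _ , atj with edge-ends⁻ u v uv (subst (Inc (turn j)) atj (turn-inc j))
  ... | inj₁ refl = inj₁ (turn-onD j)
  ... | inj₂ refl = inj₂ (turn-onD j)

  D-centres-M : ∀ v → ¬ OnCycle D v → ∀ e f → M e f → ¬ (Inc v e × Inc v f)
  D-centres-M v v∉D e f ef (ve , vf) with at-cycleEdge (M⊆H e f ef)
  ... | j , ends = v∉D (subst (OnCycle D) (sym (v≡turn ends)) (turn-onD j))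
    where
    e≢f = proj₁ (M-edge e f ef)
    v≡turn : (at j ≡ e × at (suc j) ≡ f) ⊎ (at j ≡ f × at (suc j) ≡ e) → v ≡ turn j
    v≡turn (inj₁ (p , q)) = common-end-unique e f e≢f ve vf (subst (Inc _) p (turn-inc j)) (subst (Inc _) q (turn-inc-suc j))
    v≡turn (inj₂ (p , q)) = common-end-unique e f e≢f ve vf (subst (Inc _) q (turn-inc-suc j)) (subst (Inc _) p (turn-inc j))

module _ {A : Set} where

  Consec-++⁺ˡ : ∀ {xs ys : List A} {a b} → Consec xs a b → Consec (xs ++ ys) a b
  Consec-++⁺ˡ here      = here
  Consec-++⁺ˡ (there c) = there (Consec-++⁺ˡ c)

  Consec-++⁺ʳ : ∀ (xs : List A) {ys a b} → Consec ys a b → Consec (xs ++ ys) a b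
  Consec-++⁺ʳ []       c = c
  Consec-++⁺ʳ (x ∷ xs) c = there (Consec-++⁺ʳ xs c)

  Consec-++⁺ : ∀ {xs ys : List A} {a b} → Last xs a → Head ys b → Consec (xs ++ ys) a b
  Consec-++⁺ {ys = _ ∷ _} single   refl = here
  Consec-++⁺              (cons l) h    = there (Consec-++⁺ l h)

  Consec-++⁻ : ∀ (xs : List A) {ys a b} → Consec (xs ++ ys) a b →
               Consec xs a b ⊎ Consec ys a b ⊎ (Last xs a × Head ys b)
  Consec-++⁻ []            c         = inj₂ (inj₁ c)
  Consec-++⁻ (x ∷ [])      {_ ∷ _} here = inj₂ (inj₂ (single , refl))
  Consec-++⁻ (x ∷ [])      (there c) = inj₂ (inj₁ c)
  Consec-++⁻ (x ∷ x′ ∷ xs) here      = inj₁ here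
  Consec-++⁻ (x ∷ x′ ∷ xs) (there c) with Consec-++⁻ (x′ ∷ xs) c
  ... | inj₁ c′             = inj₁ (there c′)
  ... | inj₂ (inj₁ c′)      = inj₂ (inj₁ c′)
  ... | inj₂ (inj₂ (l , h)) = inj₂ (inj₂ (cons l , h))

  Last-++⁺ : ∀ (xs : List A) {ys a} → Last ys a → Last (xs ++ ys) a
  Last-++⁺ []           l = l
  Last-++⁺ (x ∷ [])     l = cons l
  Last-++⁺ (x ∷ x′ ∷ xs) l = cons (Last-++⁺ (x′ ∷ xs) l)

  Last-functional : ∀ {xs : List A} {a b} → Last xs a → Last xs b → a ≡ b
  Last-functional single   single    = refl
  Last-functional (cons l) (cons l′) = Last-functional l l′

  Head-++ : ∀ (xs : List A) {y ys zs b} → Head ((xs ++ y ∷ ys) ++ zs) b ≡ Head (xs ++ y ∷ ys) b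
  Head-++ []      = refl
  Head-++ (_ ∷ _) = refl

module Blocks {A : Set} (pre : ℕ → List A) (end : ℕ → A) where

  block : ℕ → List A
  block k = pre k ++ end k ∷ []

  blocks : ℕ → ℕ → List A
  blocks s zero    = []
  blocks s (suc c) = block s ++ blocks (suc s) c

  Last-block⁺ : ∀ k → Last (block k) (end k)
  Last-block⁺ k = Last-++⁺ (pre k) single

  Last-block : ∀ k {a} → Last (block k) a → a ≡ end k
  Last-block k l = Last-functional l (Last-block⁺ k)

  ∈-block-end : ∀ k → end k ∈ block k
  ∈-block-end k = ∈-++⁺ʳ (pre k) (here refl)

  private
    step-range : ∀ s c {k} → s ≢ k → s ≤ k → k < s + suc c → suc s ≤ k × k < suc s + c
    step-range s c {k} s≢k s≤k k< = ℕₚ.≤∧≢⇒< s≤k s≢k , subst (k <_) (ℕₚ.+-suc s c) k<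

    unstep-range : ∀ s c {k} → suc s ≤ k → k < suc s + c → s ≤ k × k < s + suc c
    unstep-range s c {k} s<k k< = ℕₚ.<⇒≤ s<k , subst (k <_) (sym (ℕₚ.+-suc s c)) k<

    empty-range : ∀ s {k} → s ≤ k → k < s + 0 → ⊥
    empty-range s s≤k k< = ℕₚ.<-irrefl refl (ℕₚ.≤-trans k< (subst (_≤ _) (sym (ℕₚ.+-identityʳ s)) s≤k))

    here-range : ∀ s c → s ≤ s × s < s + suc c
    here-range s c = ℕₚ.≤-refl , ℕₚ.m<m+n s (s≤s z≤n)

  ∈-blocks⁺ : ∀ s c {k y} → s ≤ k → k < s + c → y ∈ block k → y ∈ blocks s c
  ∈-blocks⁺ s zero    s≤k k< _  = ⊥-elim (empty-range s s≤k k<)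
  ∈-blocks⁺ s (suc c) {k} s≤k k< y∈ with s ℕ.≟ k
  ... | yes refl = ∈-++⁺ˡ y∈
  ... | no  s≢k  = ∈-++⁺ʳ (block s) (uncurry (∈-blocks⁺ (suc s) c) (step-range s c s≢k s≤k k<) y∈)

  ∈-blocks⁻ : ∀ s c {y} → y ∈ blocks s c → ∃ λ k → (s ≤ k × k < s + c) × y ∈ block k
  ∈-blocks⁻ s (suc c) y∈ with ∈-++⁻ (block s) y∈
  ... | inj₁ y∈′ = s , here-range s c , y∈′
  ... | inj₂ y∈′ with ∈-blocks⁻ (suc s) c y∈′
  ... | k , range , y∈″ = k , uncurry (unstep-range s c) range , y∈″

  Consec-blocks⁺ : ∀ s c {k a b} → s ≤ k → k < s + c → Consec (block k) a b → Consec (blocks s c) a b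
  Consec-blocks⁺ s zero    s≤k k< _ = ⊥-elim (empty-range s s≤k k<)
  Consec-blocks⁺ s (suc c) {k} s≤k k< ab with s ℕ.≟ k
  ... | yes refl = Consec-++⁺ˡ ab
  ... | no  s≢k  = Consec-++⁺ʳ (block s) (uncurry (Consec-blocks⁺ (suc s) c) (step-range s c s≢k s≤k k<) ab)

  Consec-blocks-end⁺ : ∀ s c {k b} → s ≤ k → suc k < s + c → Head (block (suc k)) b → Consec (blocks s c) (end k) b
  Consec-blocks-end⁺ s zero s≤k sk< _ = ⊥-elim (empty-range s s≤k (ℕₚ.<-trans (ℕₚ.n<1+n _) sk<))
  Consec-blocks-end⁺ s (suc c) {k} s≤k sk< h with s ℕ.≟ k
  Consec-blocks-end⁺ s (suc zero)    s≤k sk< h | yes refl = ⊥-elim (ℕₚ.<-irrefl refl (subst (suc s <_) (ℕₚ.+-comm s 1) sk<))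
  Consec-blocks-end⁺ s (suc (suc c)) s≤k sk< h | yes refl = Consec-++⁺ (Last-block⁺ s) (subst id (sym (Head-++ (pre (suc s)))) h)
  Consec-blocks-end⁺ s (suc c) {k} s≤k sk< h   | no s≢k   = Consec-++⁺ʳ (block s) (Consec-blocks-end⁺ (suc s) c (ℕₚ.≤∧≢⇒< s≤k s≢k) (subst (suc k <_) (ℕₚ.+-suc s c) sk<) h)

  Consec-blocks⁻ : ∀ s c {a b} → Consec (blocks s c) a b → ∃ λ k → (s ≤ k × k < s + c) ×
                   (Consec (block k) a b ⊎ (suc k < s + c × a ≡ end k × Head (block (suc k)) b))
  Consec-blocks⁻ s (suc c) ab with Consec-++⁻ (block s) ab
  ... | inj₁ ab′ = s , here-range s c , inj₁ ab′
  ... | inj₂ (inj₁ ab′) with Consec-blocks⁻ (suc s) c ab′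
  ...   | k , range , inj₁ ab″ = k , uncurry (unstep-range s c) range , inj₁ ab″
  ...   | k , range , inj₂ (sk< , rest) = k , uncurry (unstep-range s c) range , inj₂ (subst (suc k <_) (sym (ℕₚ.+-suc s c)) sk< , rest)
  Consec-blocks⁻ s (suc zero)    ab | inj₂ (inj₂ (_ , ()))
  Consec-blocks⁻ s (suc (suc c)) ab | inj₂ (inj₂ (l , h)) =
    s , here-range s (suc c) , inj₂ (subst (_< s + suc (suc c)) (ℕₚ.+-comm s 1) (ℕₚ.+-monoʳ-< s (s≤s (s≤s z≤n))) , Last-block s l , subst id (Head-++ (pre (suc s))) h)

  Last-blocks⁺ : ∀ s c → Last (blocks s (suc c)) (end (s + c))
  Last-blocks⁺ s zero    = subst₂ Last (sym (Listₚ.++-identityʳ (block s))) (cong end (sym (ℕₚ.+-identityʳ s))) (Last-block⁺ s)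
  Last-blocks⁺ s (suc c) = subst (Last (blocks s (suc (suc c)))) (cong end (sym (ℕₚ.+-suc s c)))
                                 (Last-++⁺ (block s) (Last-blocks⁺ (suc s) c))

  Head-blocks : ∀ s c {b} → Head (blocks s (suc c)) b ≡ Head (block s) b
  Head-blocks s c = Head-++ (pre s)

  blocks-unique : ∀ N → (∀ k → Unique (block k)) →
                  (∀ {k k′ y} → k < N → k′ < N → y ∈ block k → y ∈ block k′ → k ≡ k′) →
                  ∀ s c → s + c ≤ N → Unique (blocks s c)
  blocks-unique N uniq disj s zero    _     = []
  blocks-unique N uniq disj s (suc c) s+c≤N =
    AllPairs.++⁺ (uniq s) (blocks-unique N uniq disj (suc s) c sc≤N)
                 (All.tabulate λ y∈ → All.tabulate λ z∈ y≡z → apart y∈ z∈ y≡z)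
    where
    sc≤N : suc s + c ≤ N
    sc≤N = subst (_≤ N) (ℕₚ.+-suc s c) s+c≤N
    apart : ∀ {y z} → y ∈ block s → z ∈ blocks (suc s) c → y ≢ z
    apart y∈ z∈ refl with ∈-blocks⁻ (suc s) c z∈
    ... | k , (s<k , k<) , z∈′ =
      ℕₚ.<-irrefl (disj (ℕₚ.<-≤-trans (ℕₚ.m<m+n s (s≤s z≤n)) s+c≤N) (ℕₚ.<-≤-trans k< sc≤N) y∈ z∈′) s<k

  length-blocks : ∀ s c → c ≤ length (blocks s c)
  length-blocks s zero    = z≤n
  length-blocks s (suc c) =
    subst (suc c ≤_) (sym (Listₚ.length-++ (block s)))
          (ℕₚ.+-mono-≤ (subst (1 ≤_) (sym (Listₚ.length-++ (pre s))) (ℕₚ.m≤n+m 1 (length (pre s)))) (length-blocks (suc s) c))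

-- From a dominating cycle of G to a hamiltonian cycle of L(G) through M

module ToHamiltonian {n : ℕ} (G : Graph n) (Δ≤3 : MaxDegree≤ G 3) (PM : PerfectMatching G)
                     (D : Cycle (Fin n) (Adj G))
                     (centred : ∀ v → ¬ OnCycle D v → ∀ e f → PerfectMatching.M PM e f →
                                  ¬ (Incident G v e × Incident G v f)) where
  open Edges G
  open Periodic D renaming (at to d; at-step to d-step)
  open Partner PM

  abstract
    cyc : ℕ → E
    cyc k = edge (d k) (d (suc k)) (d-step k)

    cyc-inc : ∀ k → Inc (d k) (cyc k)
    cyc-inc k = proj₁ (edge-ends (d k) (d (suc k)) (d-step k))

    cyc-inc-suc : ∀ k → Inc (d (suc k)) (cyc k)
    cyc-inc-suc k = proj₂ (edge-ends (d k) (d (suc k)) (d-step k))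

    cyc-ends⁻ : ∀ {z} k → Inc z (cyc k) → z ≡ d k ⊎ z ≡ d (suc k)
    cyc-ends⁻ k = edge-ends⁻ (d k) (d (suc k)) (d-step k)

  d-suc-≢ : ∀ k → d k ≢ d (suc k)
  d-suc-≢ k = Adj⇒≢ (d-step k)

  cyc-cong : ∀ a b → a % L ≡ b % L → cyc a ≡ cyc b
  cyc-cong a b e = ends-injective (cyc a) (cyc b) (d-suc-≢ a) (cyc-inc a) (cyc-inc-suc a)
                     (subst (λ z → Inc z (cyc b)) (at-cong b a (sym e)) (cyc-inc b))
                     (subst (λ z → Inc z (cyc b)) (at-cong (suc b) (suc a) (suc-%-cong b a (sym e))) (cyc-inc-suc b))

  -- A cycle edge cannot coincide with the one two steps further, as L ≥ 3.
  cyc-injective : ∀ a b → cyc a ≡ cyc b → a % L ≡ b % L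
  cyc-injective a b e with cyc-ends⁻ b (subst (Inc (d a)) e (cyc-inc a))
  ... | inj₁ p = at-injective a b p
  ... | inj₂ p with cyc-ends⁻ b (subst (Inc (d (suc a))) e (cyc-inc-suc a))
  ...   | inj₂ q = ⊥-elim (d-suc-≢ a (trans p (sym q)))
  ...   | inj₁ q = ⊥-elim (+-%-≢ b (s≤s z≤n) (s≤s (s≤s (s≤s z≤n)))
                    (trans (cong (_% L) (ℕₚ.+-comm b 2))
                           (trans (sym (suc-%-cong a (suc b) (at-injective a (suc b) p))) (at-injective (suc a) b q))))

  cyc-suc-≢ : ∀ k → cyc k ≢ cyc (suc k)
  cyc-suc-≢ k e = +-%-≢ k (s≤s z≤n) (s≤s (s≤s z≤n)) (trans (cong (_% L) (ℕₚ.+-comm k 1)) (sym (cyc-injective k (suc k) e)))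

  OnD : E → Set
  OnD g = ∃ λ (i : Fin L) → g ≡ cyc (toℕ i)

  abstract
    OnD? : ∀ g → Dec (OnD g)
    OnD? g = Finₚ.any? (λ i → g ≟ᴱ cyc (toℕ i))

  cyc-OnD : ∀ k → OnD (cyc k)
  cyc-OnD k = k mod L , cyc-cong k (toℕ (k mod L)) (sym (trans (cong (_% L) (toℕ-mod k)) (m%n%n≡m%n k L)))

  OnD-at : ∀ {k g} → Inc (d (suc k)) g → OnD g → g ≡ cyc k ⊎ g ≡ cyc (suc k)
  OnD-at {k} ig (i , refl) with cyc-ends⁻ (toℕ i) ig
  ... | inj₁ p = inj₂ (cyc-cong (toℕ i) (suc k) (sym (at-injective (suc k) (toℕ i) p)))
  ... | inj₂ p = inj₁ (cyc-cong (toℕ i) k (sym (suc-%-cancel k (toℕ i) (at-injective (suc k) (suc (toℕ i)) p))))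

  -- Two cycle edges already meet at d (suc k), so by Δ ≤ 3 at most one other edge does.
  off-D-unique : ∀ {k g g′} → ¬ OnD g → ¬ OnD g′ → Inc (d (suc k)) g → Inc (d (suc k)) g′ → g ≡ g′
  off-D-unique {k} {g} {g′} g∉ g′∉ ig ig′ with g ≟ᴱ g′
  ... | yes g≡g′ = g≡g′
  ... | no  g≢g′ = ⊥-elim (¬4-incident-edges Δ≤3
          ( (cyc-suc-≢ k ∷ (g∉ ∘ cyc-OnD′ k) ∷ (g′∉ ∘ cyc-OnD′ k) ∷ [])
          ∷ ((g∉ ∘ cyc-OnD′ (suc k)) ∷ (g′∉ ∘ cyc-OnD′ (suc k)) ∷ [])
          ∷ (g≢g′ ∷ []) ∷ [] ∷ [])
          (cyc-inc-suc k ∷ cyc-inc (suc k) ∷ ig ∷ ig′ ∷ []))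
    where
    cyc-OnD′ : ∀ j {h} → cyc j ≡ h → OnD h
    cyc-OnD′ j refl = cyc-OnD j

  OffAt : ℕ → E → Set
  OffAt k g = ¬ OnD g × Inc (d (suc k)) g

  abstract
    OffAt? : ∀ k g → Dec (OffAt k g)
    OffAt? k g with OnD? g | Inc? (d (suc k)) g
    ... | yes g∈ | _     = no (λ off → proj₁ off g∈)
    ... | no g∉  | yes i = yes (g∉ , i)
    ... | no _   | no ¬i = no (¬i ∘ proj₂)

  Matched : ℕ → E → Set
  Matched k g = M (cyc k) g ⊎ M (cyc (suc k)) g

  detour : ℕ → List E
  detour k with OffAt? k (partner (cyc k)) | OffAt? k (partner (cyc (suc k)))
  ... | yes _ | _     = partner (cyc k) ∷ []
  ... | no _  | yes _ = partner (cyc (suc k)) ∷ []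
  ... | no _  | no _  = []

  detour-view : ∀ k → detour k ≡ [] ⊎ ∃ λ g → detour k ≡ g ∷ [] × OffAt k g × Matched k g
  detour-view k with OffAt? k (partner (cyc k)) | OffAt? k (partner (cyc (suc k)))
  ... | yes off | _       = inj₂ (_ , refl , off , inj₁ (M-partner (cyc k)))
  ... | no _    | yes off = inj₂ (_ , refl , off , inj₂ (M-partner (cyc (suc k))))
  ... | no _    | no _    = inj₁ refl

  detour-complete : ∀ k g → OffAt k g → Matched k g → detour k ≡ g ∷ []
  detour-complete k g off m with OffAt? k (partner (cyc k)) | OffAt? k (partner (cyc (suc k))) | m
  ... | yes off′ | _       | _    = cong (_∷ []) (off-D-unique {k} (proj₁ off′) (proj₁ off) (proj₂ off′) (proj₂ off))
  ... | no ¬off  | _       | inj₁ m₁ = ⊥-elim (¬off (subst (OffAt k) (partner-unique (cyc k) g m₁) off))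
  ... | no _     | yes _   | inj₂ m₂ = cong (_∷ []) (sym (partner-unique (cyc (suc k)) g m₂))
  ... | no _     | no ¬off | inj₂ m₂ = ⊥-elim (¬off (subst (OffAt k) (partner-unique (cyc (suc k)) g m₂) off))

  detour-sound : ∀ k {g} → detour k ≡ g ∷ [] → OffAt k g × Matched k g
  detour-sound k {g} eq with detour-view k
  ... | inj₁ eq′ with () ← trans (sym eq) eq′
  ... | inj₂ (g′ , eq′ , off , m) with trans (sym eq) eq′
  ...   | refl = off , m

  detour-[] : ∀ k → M (cyc k) (cyc (suc k)) → detour k ≡ []
  detour-[] k m with detour-view k
  ... | inj₁ eq = eq
  ... | inj₂ (g , _ , (g∉ , _) , inj₁ m₁) =
    ⊥-elim (g∉ (subst OnD (trans (partner-unique (cyc k) _ m) (sym (partner-unique (cyc k) g m₁))) (cyc-OnD (suc k))))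
  ... | inj₂ (g , _ , (g∉ , _) , inj₂ m₂) =
    ⊥-elim (g∉ (subst OnD (trans (partner-unique (cyc (suc k)) _ (M-sym _ _ m)) (sym (partner-unique (cyc (suc k)) g m₂))) (cyc-OnD k)))

  matched-partner : ∀ k {g} → Matched k g → Inc (d (suc k)) (partner g) × OnD (partner g)
  matched-partner k {g} (inj₁ m) = subst (λ e → Inc (d (suc k)) e × OnD e) (partner-unique g _ (M-sym _ _ m))
                                         (cyc-inc-suc k , cyc-OnD k)
  matched-partner k {g} (inj₂ m) = subst (λ e → Inc (d (suc k)) e × OnD e) (partner-unique g _ (M-sym _ _ m))
                                         (cyc-inc (suc k) , cyc-OnD (suc k))

  open Blocks detour (cyc ∘ suc)

  Consec-block⁻ : ∀ k {a b} → Consec (block k) a b → detour k ≡ a ∷ [] × b ≡ cyc (suc k)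
  Consec-block⁻ k c with detour k | detour-view k
  ... | _ | inj₁ refl with c
  ...   | there ()
  Consec-block⁻ k c | _ | inj₂ (_ , refl , _) with c
  ...   | here             = refl , refl
  ...   | there (there ())

  Head-block⁻ : ∀ k {b} → Head (block k) b → detour k ≡ b ∷ [] ⊎ (detour k ≡ [] × b ≡ cyc (suc k))
  Head-block⁻ k h with detour k | detour-view k
  ... | _ | inj₁ refl           = inj₂ (refl , sym h)
  ... | _ | inj₂ (_ , refl , _) = inj₁ (cong (_∷ []) h)

  ∈-block⁻ : ∀ k {y} → y ∈ block k → detour k ≡ y ∷ [] ⊎ y ≡ cyc (suc k)
  ∈-block⁻ k y∈ with detour k | detour-view k
  ... | _ | inj₁ refl with y∈
  ...   | here y≡ = inj₂ y≡
  ∈-block⁻ k y∈ | _ | inj₂ (_ , refl , _) with y∈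
  ...   | here refl         = inj₁ refl
  ...   | there (here y≡)   = inj₂ y≡

  Head-block⁺ : ∀ k {g} → detour k ≡ g ∷ [] → Head (block k) g
  Head-block⁺ k {g} eq = subst (λ ds → Head (ds ++ cyc (suc k) ∷ []) g) (sym eq) refl

  Head-block-[] : ∀ k → detour k ≡ [] → Head (block k) (cyc (suc k))
  Head-block-[] k eq = subst (λ ds → Head (ds ++ cyc (suc k) ∷ []) (cyc (suc k))) (sym eq) refl

  ∈-block⁺ : ∀ k {g} → detour k ≡ g ∷ [] → g ∈ block k
  ∈-block⁺ k {g} eq = subst (λ ds → g ∈ ds ++ cyc (suc k) ∷ []) (sym eq) (here refl)

  Consec-block⁺ : ∀ k {g} → detour k ≡ g ∷ [] → Consec (block k) g (cyc (suc k))
  Consec-block⁺ k {g} eq = subst (λ ds → Consec (ds ++ cyc (suc k) ∷ []) g (cyc (suc k))) (sym eq) here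

  block-unique : ∀ k → Unique (block k)
  block-unique k with detour k | detour-view k
  ... | _ | inj₁ refl                        = [] ∷ []
  ... | _ | inj₂ (g , refl , (g∉ , _) , _) = ((g∉ ∘ λ { refl → cyc-OnD (suc k) }) ∷ []) ∷ [] ∷ []

  blocks-disjoint : ∀ {k k′ y} → k < L → k′ < L → y ∈ block k → y ∈ block k′ → k ≡ k′
  blocks-disjoint {k} {k′} {y} k<L k′<L y∈ y∈′ with ∈-block⁻ k y∈ | ∈-block⁻ k′ y∈′
  ... | inj₂ p | inj₂ p′ = %-injective-< k<L k′<L (suc-%-cancel k k′ (cyc-injective (suc k) (suc k′) (trans (sym p) p′)))
  ... | inj₁ eq | inj₂ p′ = ⊥-elim (proj₁ (proj₁ (detour-sound k eq)) (subst OnD (sym p′) (cyc-OnD (suc k′))))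
  ... | inj₂ p | inj₁ eq′ = ⊥-elim (proj₁ (proj₁ (detour-sound k′ eq′)) (subst OnD (sym p) (cyc-OnD (suc k))))
  ... | inj₁ eq | inj₁ eq′ with detour-sound k eq | detour-sound k′ eq′ | d (suc k) Fin.≟ d (suc k′)
  ...   | _ | _ | yes p = %-injective-< k<L k′<L (suc-%-cancel k k′ (at-injective (suc k) (suc k′) p))
  ...   | (y∉ , iy) , m | (_ , iy′) , m′ | no ¬p =
    ⊥-elim (y∉ (subst OnD (sym (ends-injective y (partner y) ¬p iy iy′
                                  (proj₁ (matched-partner k m)) (proj₁ (matched-partner k′ m′))))
                          (proj₂ (matched-partner k m))))

  tour : List E
  tour = blocks 0 L

  cyc-L : cyc L ≡ cyc 0
  cyc-L = cyc-cong L 0 (n%n≡0 L)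

  Last-tour : ∀ {a} → Last tour a → a ≡ cyc 0
  Last-tour l = trans (Last-functional l (Last-blocks⁺ 0 (2 + Cycle.m D))) cyc-L

  cyc-LAdj-head : ∀ k {b} → Head (block k) b → LAdj G (cyc k) b
  cyc-LAdj-head k h with Head-block⁻ k h
  ... | inj₁ eq with detour-sound k eq
  ...   | (b∉ , ib) , _ = (λ { refl → b∉ (cyc-OnD k) }) , d (suc k) , cyc-inc-suc k , ib
  cyc-LAdj-head k h | inj₂ (_ , refl) = cyc-suc-≢ k , d (suc k) , cyc-inc-suc k , cyc-inc (suc k)

  tour-adjacent : ∀ a b → CyclicConsec tour a b → LAdj G a b
  tour-adjacent a b (inj₁ c) with Consec-blocks⁻ 0 L c
  ... | k , _ , inj₂ (_ , refl , h) = cyc-LAdj-head (suc k) h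
  ... | k , _ , inj₁ c′ with Consec-block⁻ k c′
  ...   | eq , refl with detour-sound k eq
  ...     | (a∉ , ia) , _ = (λ { refl → a∉ (cyc-OnD (suc k)) }) , d (suc k) , ia , cyc-inc (suc k)
  tour-adjacent a b (inj₂ (l , h)) with Last-tour l
  ... | refl = cyc-LAdj-head 0 (subst id (Head-blocks 0 (2 + Cycle.m D)) h)

  tourCycle : Σ (LineCycle G) λ H → (∀ g → g ∈ tour → OnCycle H g) × (∀ a b → CyclicConsec tour a b → CycleEdge H a b)
  tourCycle = listCycle tour (ℕₚ.≤-trans (s≤s (s≤s (s≤s z≤n))) (length-blocks 0 L))
                        (blocks-unique L block-unique blocks-disjoint 0 L ℕₚ.≤-refl) tour-adjacent

  H : LineCycle G
  H = proj₁ tourCycle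

  tour-edge : ∀ {a b} → CyclicConsec tour a b → CycleEdge H a b
  tour-edge = proj₂ (proj₂ tourCycle) _ _

  ∈-tour : ∀ k {g} → k < L → g ∈ block k → g ∈ tour
  ∈-tour k k<L = ∈-blocks⁺ 0 L z≤n k<L

  tour-within-block : ∀ k {g} → k < L → detour k ≡ g ∷ [] → CyclicConsec tour g (cyc (suc k))
  tour-within-block k k<L eq = inj₁ (Consec-blocks⁺ 0 L z≤n k<L (Consec-block⁺ k eq))

  tour-into-block : ∀ k {b} → k < L → Head (block k) b → CyclicConsec tour (cyc k) b
  tour-into-block zero    _   h = inj₂ (subst (Last tour) cyc-L (Last-blocks⁺ 0 (2 + Cycle.m D)) ,
                                        subst id (sym (Head-blocks 0 (2 + Cycle.m D))) h)
  tour-into-block (suc k) k<L h = inj₁ (Consec-blocks-end⁺ 0 L z≤n k<L h)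

  vertex-onD : ∀ {z} → OnCycle D z → ∃ λ k → k < L × d (suc k) ≡ z
  vertex-onD z∈ with at-onCycle z∈
  ... | zero  , _   , d0≡z = 2 + Cycle.m D , ℕₚ.n<1+n _ , trans (at-cong L 0 (n%n≡0 L)) d0≡z
  ... | suc k , k<L , dk≡z = k , ℕₚ.<-trans (ℕₚ.n<1+n k) k<L , dk≡z

  M-meets-D : ∀ {e f} → M e f → ∃ λ k → k < L × Inc (d (suc k)) e × Inc (d (suc k)) f
  M-meets-D {e} {f} m with M-edge e f m
  ... | _ , z , ie , if with Finₚ.any? (λ i → Cycle.vtx D i Fin.≟ z)
  ...   | no  z∉ = ⊥-elim (centred z z∉ e f m (ie , if))
  ...   | yes z∈ with vertex-onD z∈
  ...     | k , k<L , refl = k , k<L , ie , if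

  edge-at : ∀ k {g} → Inc (d (suc k)) g → g ≡ cyc k ⊎ g ≡ cyc (suc k) ⊎ OffAt k g
  edge-at k {g} ig with OnD? g
  ... | yes g∈ = map₂ inj₁ (OnD-at ig g∈)
  ... | no  g∉ = inj₂ (inj₂ (g∉ , ig))

  cyc-∈-tour : ∀ {g} → OnD g → g ∈ tour
  cyc-∈-tour (i , refl) with toℕ i in eq
  ... | zero  = ∈-tour (2 + Cycle.m D) (ℕₚ.n<1+n _) (subst (_∈ block (2 + Cycle.m D)) cyc-L (∈-block-end _))
  ... | suc j = ∈-tour j (ℕₚ.<-trans (ℕₚ.n<1+n j) (subst (_< L) eq (Finₚ.toℕ<n i))) (∈-block-end j)

  -- An edge off D is matched into some d (suc k), where its partner is one of the two cycle edges:
  -- its partner cannot be off D too, as at most one edge at d (suc k) is.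
  off-∈-tour : ∀ {g} → ¬ OnD g → g ∈ tour
  off-∈-tour {g} g∉ with M-meets-D (M-partner g)
  ... | k , k<L , ig , ip with edge-at k ip
  ...   | inj₁ p≡          = ∈-tour k k<L (∈-block⁺ k (detour-complete k g (g∉ , ig) (inj₁ (partner-M p≡))))
  ...   | inj₂ (inj₁ p≡)   = ∈-tour k k<L (∈-block⁺ k (detour-complete k g (g∉ , ig) (inj₂ (partner-M p≡))))
  ...   | inj₂ (inj₂ off) = ⊥-elim (partner≢ g (sym (off-D-unique {k} g∉ (proj₁ off) ig ip)))

  H-hamiltonian : Hamiltonian H
  H-hamiltonian g with OnD? g
  ... | yes g∈ = proj₁ (proj₂ tourCycle) g (cyc-∈-tour g∈)
  ... | no  g∉ = proj₁ (proj₂ tourCycle) g (off-∈-tour g∉)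

  -- Both edges of an M-edge meet at some d (suc k), and each is cyc k, cyc (suc k) or the detour there.
  M⊆H : ∀ e f → M e f → CycleEdge H e f
  M⊆H e f m with M-meets-D m
  ... | k , k<L , ie , if = joined (edge-at k ie) (edge-at k if)
    where
    e≢f = proj₁ (M-edge e f m)
    joined : e ≡ cyc k ⊎ e ≡ cyc (suc k) ⊎ OffAt k e → f ≡ cyc k ⊎ f ≡ cyc (suc k) ⊎ OffAt k f → CycleEdge H e f
    joined (inj₁ refl)        (inj₁ refl)        = ⊥-elim (e≢f refl)
    joined (inj₂ (inj₁ refl)) (inj₂ (inj₁ refl)) = ⊥-elim (e≢f refl)
    joined (inj₁ refl)        (inj₂ (inj₁ refl)) = tour-edge (tour-into-block k k<L (Head-block-[] k (detour-[] k m)))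
    joined (inj₂ (inj₁ refl)) (inj₁ refl)        =
      CycleEdge-sym {C = H} (tour-edge (tour-into-block k k<L (Head-block-[] k (detour-[] k (M-sym e f m)))))
    joined (inj₁ refl)        (inj₂ (inj₂ off))  = tour-edge (tour-into-block k k<L (Head-block⁺ k (detour-complete k f off (inj₁ m))))
    joined (inj₂ (inj₂ off))  (inj₁ refl)        =
      CycleEdge-sym {C = H} (tour-edge (tour-into-block k k<L (Head-block⁺ k (detour-complete k e off (inj₁ (M-sym e f m))))))
    joined (inj₂ (inj₁ refl)) (inj₂ (inj₂ off))  = CycleEdge-sym {C = H} (tour-edge (tour-within-block k k<L (detour-complete k f off (inj₂ m))))
    joined (inj₂ (inj₂ off))  (inj₂ (inj₁ refl)) = tour-edge (tour-within-block k k<L (detour-complete k e off (inj₂ (M-sym e f m))))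
    joined (inj₂ (inj₂ off))  (inj₂ (inj₂ off′)) = ⊥-elim (e≢f (off-D-unique {k} (proj₁ off) (proj₁ off′) ie if))

lemma1 : {n : ℕ} (G : Graph n) → 3 ≤ n → Connected G → MaxDegree≤ G 3 →
         (PM : PerfectMatching G) →
         (Σ (LineCycle G) λ H → Hamiltonian H ×
            (∀ e f → PerfectMatching.M PM e f → CycleEdge H e f))
         ⇔
         (Σ (Cycle (Fin n) (Adj G)) λ D → Dominating G D ×
            (∀ v → ¬ OnCycle D v → ∀ e f → PerfectMatching.M PM e f →
               ¬ (Incident G v e × Incident G v f)))
lemma1 G _ _ Δ≤3 PM = mk⇔
  (λ (H , ham , M⊆H) → let open FromHamiltonian G Δ≤3 PM H ham M⊆H in D , D-dominating , D-centres-M)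
  (λ (D , _ , centred) → let open ToHamiltonian G Δ≤3 PM D centred in H , H-hamiltonian , M⊆H)
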